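{- The underlying undirected graph of any 2-qBMG is $C_6$-free, i.e. it has no induced subgraph isomorphic to the cycle graph $C_6$ on six vertices.
   Context: A two-color quasi best match graph (2-qBMG) is a bipartite directed graph $\overrightarrow{G}$ (vertex set split into two color classes, every edge joining vertices of different colors) without loops and parallel edges, satisfying: (N1) if $u$ and $v$ are two independent (non-adjacent) vertices then there exist no vertices $w,t$ such that $ut, vw, tw$ are edges; (N2) if $uv, vw, wt$ are edges then $ut$ is an edge; (N3) if $u$ and $v$ have a common out-neighbor then either every out-neighbor of $u$ is an out-neighbor of $v$ or every out-neighbor of $v$ is an out-neighbor of $u$. The underlying undirected graph of a digraph has the same vertex set and an undirected edge $\{u,v\}$ whenever $uv$ or $vu$ is a directed edge. The cycle graph $C_6$ has vertices $v_1,\dots,v_6$ and exactly the edges $v_iv_{i+1}$ ($1\le i\le5$) and $v_6v_1$. -}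

module Defs where

open import Data.Nat using (ℕ; suc)
open import Data.Fin using (Fin; zero; suc)
open import Data.Bool using (Bool)
open import Data.Product using (_×_; Σ; ∃)
open import Data.Sum using (_⊎_)
open import Relation.Nullary using (¬_)
open import Relation.Binary.PropositionalEquality using (_≡_; _≢_)
open import Function.Definitions using (Injective)

record Digraph : Set₁ where
  field
    n   : ℕ
    Arc : Fin n → Fin n → Set

open Digraph public

Coloring : Digraph → Set
Coloring G = Fin (n G) → Bool

Adj : (G : Digraph) → Fin (n G) → Fin (n G) → Set
Adj G u v = Arc G u v ⊎ Arc G v u

Independent : (G : Digraph) → Fin (n G) → Fin (n G) → Set
Independent G u v = ¬ Adj G u v

record Is2qBMG (G : Digraph) (σ : Coloring G) : Set where
  field
    bipartite : ∀ {u v} → Arc G u v → σ u ≢ σ v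
    loopless  : ∀ {u} → ¬ Arc G u u
    N1 : ∀ {u v} → Independent G u v →
         ∀ w t → ¬ (Arc G u t × Arc G v w × Arc G t w)
    N2 : ∀ {u v w t} → Arc G u v → Arc G v w → Arc G w t → Arc G u t
    N3 : ∀ {u v} → (∃ λ x → Arc G u x × Arc G v x) →
         (∀ y → Arc G u y → Arc G v y) ⊎ (∀ y → Arc G v y → Arc G u y)

-- Adjacency of the cycle graph C6 on Fin 6 (vertex i ~ v_{i+1}):
-- i ~ j iff j = i+1 mod 6 or i = j+1 mod 6.
next6 : Fin 6 → Fin 6
next6 zero = suc zero
next6 (suc zero) = suc (suc zero)
next6 (suc (suc zero)) = suc (suc (suc zero))
next6 (suc (suc (suc zero))) = suc (suc (suc (suc zero)))
next6 (suc (suc (suc (suc zero)))) = suc (suc (suc (suc (suc zero))))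
next6 (suc (suc (suc (suc (suc zero))))) = zero

C6Adj : Fin 6 → Fin 6 → Set
C6Adj i j = (j ≡ next6 i) ⊎ (i ≡ next6 j)

InducedC6 : (G : Digraph) → Set
InducedC6 G = Σ (Fin 6 → Fin (n G)) λ f →
  Injective _≡_ _≡_ f ×
  (∀ i j → (Adj G (f i) (f j) → C6Adj i j) × (C6Adj i j → Adj G (f i) (f j)))

C6Free : Digraph → Set
C6Free G = ¬ InducedC6 G

-- In an induced P₄ no two consecutive arcs can form a directed path: depending on the
-- orientation of the third edge this contradicts (N2) or (N1).  Every two consecutive
-- edges of an induced C₆ start such a P₄ (in one direction or the other), so the
-- arcs around the hexagon alternate in direction.  But an alternating induced P₅
-- contradicts (N3): its two sources share an out-neighbour, yet each also has an
-- out-neighbour that the other is not adjacent to.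
module Submission where

open import Defs
open import Data.Fin using (Fin; zero; suc)
open import Data.Product using (_,_; proj₁; proj₂)
open import Data.Sum using (inj₁; inj₂; swap)
open import Data.Empty using (⊥)
open import Function using (_∘_)
open import Relation.Nullary using (¬_)
open import Relation.Binary.PropositionalEquality using (refl)

module _ {G : Digraph} {σ : Coloring G} (q : Is2qBMG G σ) where
  open Is2qBMG q

  private variable
    a b c d x₀ x₁ x₂ x₃ x₄ x₅ : Fin (n G)

  independent-sym : Independent G a b → Independent G b a
  independent-sym ind = ind ∘ swap

  no-directed-2-path-in-P₄ :
    Independent G a d → Arc G a b → Arc G b c → Adj G c d → ⊥
  no-directed-2-path-in-P₄ ind ab bc (inj₁ cd) = ind (inj₁ (N2 ab bc cd))
  no-directed-2-path-in-P₄ ind ab bc (inj₂ dc) = N1 ind _ _ (ab , dc , bc)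

  no-alternating-P₅ : Independent G x₀ x₃ → Independent G x₁ x₄ →
    Arc G x₁ x₀ → Arc G x₁ x₂ → Arc G x₃ x₂ → Arc G x₃ x₄ → ⊥
  no-alternating-P₅ ind₀₃ ind₁₄ a₁₀ a₁₂ a₃₂ a₃₄ with N3 (_ , a₁₂ , a₃₂)
  ... | inj₁ out₁⊆out₃ = ind₀₃ (inj₂ (out₁⊆out₃ _ a₁₀))
  ... | inj₂ out₃⊆out₁ = ind₁₄ (inj₁ (out₃⊆out₁ _ a₃₄))

  no-hexagon-with-independent-diagonals :
    Adj G x₀ x₁ → Adj G x₁ x₂ → Adj G x₂ x₃ → Adj G x₃ x₄ → Adj G x₄ x₅ → Adj G x₅ x₀ →
    Independent G x₀ x₃ → Independent G x₁ x₄ → Independent G x₂ x₅ → ⊥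
  no-hexagon-with-independent-diagonals (inj₁ a₀₁) (inj₁ a₁₂) e₂₃ _ _ _ ind₀₃ _ _ =
    no-directed-2-path-in-P₄ ind₀₃ a₀₁ a₁₂ e₂₃
  no-hexagon-with-independent-diagonals e₀₁@(inj₁ _) (inj₂ a₂₁) (inj₂ a₃₂) _ _ _ ind₀₃ _ _ =
    no-directed-2-path-in-P₄ (independent-sym ind₀₃) a₃₂ a₂₁ (swap e₀₁)
  no-hexagon-with-independent-diagonals (inj₁ _) (inj₂ _) (inj₁ a₂₃) (inj₁ a₃₄) e₄₅ _ _ _ ind₂₅ =
    no-directed-2-path-in-P₄ ind₂₅ a₂₃ a₃₄ e₄₅
  no-hexagon-with-independent-diagonals (inj₁ _) (inj₂ _) e₂₃@(inj₁ _) (inj₂ a₄₃) (inj₂ a₅₄) _ _ _ ind₂₅ =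
    no-directed-2-path-in-P₄ (independent-sym ind₂₅) a₅₄ a₄₃ (swap e₂₃)
  no-hexagon-with-independent-diagonals (inj₁ _) (inj₂ a₂₁) (inj₁ a₂₃) (inj₂ a₄₃) (inj₁ a₄₅) _ _ ind₁₄ ind₂₅ =
    no-alternating-P₅ ind₁₄ ind₂₅ a₂₁ a₂₃ a₄₃ a₄₅
  no-hexagon-with-independent-diagonals (inj₂ a₁₀) (inj₂ a₂₁) _ _ _ e₅₀ _ _ ind₂₅ =
    no-directed-2-path-in-P₄ ind₂₅ a₂₁ a₁₀ (swap e₅₀)
  no-hexagon-with-independent-diagonals (inj₂ _) (inj₁ a₁₂) (inj₁ a₂₃) e₃₄ _ _ _ ind₁₄ _ =
    no-directed-2-path-in-P₄ ind₁₄ a₁₂ a₂₃ e₃₄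
  no-hexagon-with-independent-diagonals (inj₂ _) e₁₂@(inj₁ _) (inj₂ a₃₂) (inj₂ a₄₃) _ _ _ ind₁₄ _ =
    no-directed-2-path-in-P₄ (independent-sym ind₁₄) a₄₃ a₃₂ (swap e₁₂)
  no-hexagon-with-independent-diagonals (inj₂ a₁₀) (inj₁ a₁₂) (inj₂ a₃₂) (inj₁ a₃₄) _ _ ind₀₃ ind₁₄ _ =
    no-alternating-P₅ ind₀₃ ind₁₄ a₁₀ a₁₂ a₃₂ a₃₄

theorem3p9 : (G : Digraph) (σ : Coloring G) → Is2qBMG G σ → C6Free G
theorem3p9 G σ q (f , _ , adj) =
  no-hexagon-with-independent-diagonals q
    (cycle-edge v₀) (cycle-edge v₁) (cycle-edge v₂) (cycle-edge v₃) (cycle-edge v₄) (cycle-edge v₅)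
    (diagonal v₀ v₃ λ { (inj₁ ()) ; (inj₂ ()) })
    (diagonal v₁ v₄ λ { (inj₁ ()) ; (inj₂ ()) })
    (diagonal v₂ v₅ λ { (inj₁ ()) ; (inj₂ ()) })
  where
  v₀ v₁ v₂ v₃ v₄ v₅ : Fin 6
  v₀ = zero
  v₁ = suc zero
  v₂ = suc (suc zero)
  v₃ = suc (suc (suc zero))
  v₄ = suc (suc (suc (suc zero)))
  v₅ = suc (suc (suc (suc (suc zero))))

  cycle-edge : ∀ i → Adj G (f i) (f (next6 i))
  cycle-edge i = proj₂ (adj i (next6 i)) (inj₁ refl)

  diagonal : ∀ i j → ¬ C6Adj i j → Independent G (f i) (f j)
  diagonal i j ¬ij = ¬ij ∘ proj₁ (adj i j)
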